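{- Let $\mathcal R$ be the dcpo of partial Dedekind reals and $\iota:\mathbb R\to\mathcal R$ the map $\iota(x)=\{(p,q)\in\mathbb Q\times\mathbb Q\mid p<x\text{ and }x<q\}$. Then the image of $\iota$ is exactly the set of strongly maximal elements of $\mathcal R$.
   Context: We work constructively: informal set theory without excluded middle or choice. A Dedekind real is a pair $x=(L_x,U_x)$ of subsets of $\mathbb Q$ (write $p<x$ for $p\in L_x$ and $x<q$ for $q\in U_x$) that is bounded (some $p<x$ and some $x<q$ exist), rounded ($p<x\iff\exists r\,(p<r\wedge r<x)$, and $x<q\iff\exists s\,(s<q\wedge x<s)$), transitive ($p<x$ and $x<q$ imply $p<q$) and located (for rationals $p<q$, $p<x$ or $x<q$); $\mathbb R$ is the set of Dedekind reals. Let $\mathbb Q\times_<\mathbb Q=\{(p,q)\mid p<q\}$ with $(p,q)\prec(r,s)$ iff $p<r<s<q$. $\mathcal R$ is the rounded ideal completion: the set of subsets $I\subseteq\mathbb Q\times_<\mathbb Q$ that are lower sets for $\prec$ and directed (inhabited, any two elements have a common $\prec$-upper bound in $I$), ordered by inclusion, with directed suprema given by unions; it is a continuous dcpo. In a dcpo, $x\ll y$ if for every directed $S$ with $y\sqsubseteq\bigsqcup S$ some $s\in S$ has $x\sqsubseteq s$; Scott open sets are upper sets $U$ such that $\bigsqcup S\in U$ for directed $S$ implies some $s\in S$ lies in $U$. An element $x$ is strongly maximal if for all $u\ll v$, $u\ll x$ or there are disjoint Scott opens containing $v$ and $x$ respectively. -}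

module Defs where

open import Data.Rational using (ℚ; _<_)
open import Data.Product using (Σ; ∃; ∃-syntax; _×_; _,_)
open import Data.Sum using (_⊎_)
open import Data.Empty using (⊥)
open import Level using (Level; _⊔_)

_⟷_ : ∀ {a b : Level} → Set a → Set b → Set (a ⊔ b)
A ⟷ B = (A → B) × (B → A)

record ℝ : Set₁ where
  field
    L : ℚ → Set          -- p ∈ L  means  p < x
    U : ℚ → Set          -- q ∈ U  means  x < q
    bounded-L  : ∃[ p ] L p
    bounded-U  : ∃[ q ] U q
    rounded-L  : ∀ p → L p ⟷ (∃[ r ] (p < r × L r))
    rounded-U  : ∀ q → U q ⟷ (∃[ s ] (s < q × U s))
    transitive : ∀ p q → L p → U q → p < q
    located    : ∀ p q → p < q → L p ⊎ U q

-- Q ×_< Q and the relation ≺ .  Subsets of Q ×_< Q are represented as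
-- predicates on ℚ × ℚ all of whose members (p , q) satisfy p < q.

_≺_ : ℚ × ℚ → ℚ × ℚ → Set
(p , q) ≺ (r , s) = p < r × r < s × s < q

-- The rounded ideal completion: partial Dedekind reals.
record 𝓡 : Set₁ where
  field
    I         : ℚ × ℚ → Set
    ordered   : ∀ p q → I (p , q) → p < q
    lower     : ∀ a b → a ≺ b → I b → I a
    inhabited : ∃[ a ] I a
    directed  : ∀ a b → I a → I b → ∃[ c ] (I c × a ≺ c × b ≺ c)

_⊑_ : 𝓡 → 𝓡 → Set
J ⊑ K = ∀ a → 𝓡.I J a → 𝓡.I K a

ι : ℝ → ℚ × ℚ → Set
ι x (p , q) = ℝ.L x p × ℝ.U x q

-- I is in the image of ι (equality of subsets = extensional equality)
InImageι : 𝓡 → Set₁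
InImageι J = Σ ℝ λ x → ∀ a → 𝓡.I J a ⟷ ι x a

module DomainNotions {D : Set₁} (_≤_ : D → D → Set) where

  IsDirected : {Idx : Set} → (Idx → D) → Set
  IsDirected {Idx} α = Idx × (∀ i j → ∃[ k ] (α i ≤ α k × α j ≤ α k))

  IsSup : {Idx : Set} → (Idx → D) → D → Set₁
  IsSup α z = (∀ i → α i ≤ z) × (∀ w → (∀ i → α i ≤ w) → z ≤ w)

  _≪_ : D → D → Set₁
  x ≪ y = ∀ {Idx : Set} (α : Idx → D) → IsDirected α →
          ∀ z → IsSup α z → y ≤ z → ∃[ i ] (x ≤ α i)

  IsScottOpen : (D → Set₁) → Set₁
  IsScottOpen O =
    (∀ x y → x ≤ y → O x → O y) ×
    (∀ {Idx : Set} (α : Idx → D) → IsDirected α →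
       ∀ z → IsSup α z → O z → ∃[ i ] O (α i))

  StronglyMaximal : D → Set₂
  StronglyMaximal x =
    ∀ u v → u ≪ v →
      (u ≪ x) ⊎
      (Σ (D → Set₁) λ O → Σ (D → Set₁) λ P →
         IsScottOpen O × IsScottOpen P × O v × P x × (∀ d → O d → P d → ⊥))

open DomainNotions _⊑_ public

module Submission where

-- An ideal J ∈ 𝓡 is the image of a real exactly when its two cuts
-- { p | (p , q) ∈ J } and { q | (p , q) ∈ J } are located; everything else
-- (roundedness, transitivity) holds for every ideal.  If x is a real and
-- u ≪ v, then u ⊑ ↡(p , q) for some (p , q) ∈ v, and v contains a narrower
-- (p' , q').  Locating x against p < p' and q' < q either puts (p , q) ∈ ι x,
-- whence u ≪ ι x, or places x strictly to one side of (p' , q'), and the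
-- Scott opens "contains an interval on that side" separate v from ι x.
-- Conversely, for p < q choose (p , q) ≺ (r , s) ≺ (r' , s') and apply strong
-- maximality to ↡(r , s) ≪ ↡(r' , s').  If ↡(r , s) ≪ J then (p , q) ∈ J.
-- Otherwise J has an element b with ↡b separated from ↡(r' , s'); the two
-- intervals then cannot overlap, so b lies left of r' (giving q in the upper
-- cut) or right of s' (giving p in the lower cut).

open import Defs
open import Data.Rational using (ℚ; _<_; _≤_; _⊔_; _⊓_; _+_; _-_; 1ℚ; -_)
open import Data.Rational.Properties
  using ( <-trans; <-dense; <-irrefl; <⇒≤; ≤-refl; ≤-<-trans; <-≤-trans; _≤?_; ≰⇒>
        ; ⊔-sel; ⊓-sel; p≤p⊔q; p≤q⊔p; p⊓q≤p; p⊓q≤q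
        ; +-identityʳ; +-monoʳ-<; positive⁻¹; negative⁻¹ )
open import Data.Product using (Σ; ∃-syntax; _×_; _,_; proj₁; proj₂)
open import Data.Sum using (_⊎_; inj₁; inj₂)
open import Data.Empty using (⊥; ⊥-elim)
open import Level using (Lift; lift)
open import Relation.Nullary using (yes; no)
open import Relation.Binary.PropositionalEquality using (refl; sym; subst)

⊔-lub-< : ∀ {p q r} → p < r → q < r → p ⊔ q < r
⊔-lub-< {p} {q} p<r q<r with ⊔-sel p q
... | inj₁ p⊔q≡p = subst (_< _) (sym p⊔q≡p) p<r
... | inj₂ p⊔q≡q = subst (_< _) (sym p⊔q≡q) q<r

⊓-glb-< : ∀ {p q r} → r < p → r < q → r < p ⊓ q
⊓-glb-< {p} {q} r<p r<q with ⊓-sel p q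
... | inj₁ p⊓q≡p = subst (_ <_) (sym p⊓q≡p) r<p
... | inj₂ p⊓q≡q = subst (_ <_) (sym p⊓q≡q) r<q

p-1<p : ∀ p → p - 1ℚ < p
p-1<p p = subst (p - 1ℚ <_) (+-identityʳ p) (+-monoʳ-< p (negative⁻¹ (- 1ℚ)))

p<p+1 : ∀ p → p < p + 1ℚ
p<p+1 p = subst (_< p + 1ℚ) (+-identityʳ p) (+-monoʳ-< p (positive⁻¹ 1ℚ))

≺-trans : ∀ {a b c} → a ≺ b → b ≺ c → a ≺ c
≺-trans (a₁<b₁ , _ , b₂<a₂) (b₁<c₁ , c₁<c₂ , c₂<b₂) =
  <-trans a₁<b₁ b₁<c₁ , c₁<c₂ , <-trans c₂<b₂ b₂<a₂

≺-wider : ∀ {p q} → p < q → ∃[ a ] (a ≺ (p , q))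
≺-wider {p} {q} p<q = (p - 1ℚ , q + 1ℚ) , p-1<p p , p<q , p<p+1 q

≺-narrower : ∀ {p q} → p < q → ∃[ c ] ((p , q) ≺ c)
≺-narrower p<q with <-dense p<q
... | m , p<m , m<q with <-dense p<m | <-dense m<q
...   | r , p<r , r<m | s , m<s , s<q = (r , s) , p<r , <-trans r<m m<s , s<q

overlap⇒⊔<⊓ : ∀ {b c} → proj₁ b < proj₂ b → proj₁ c < proj₂ c →
            proj₁ b < proj₂ c → proj₁ c < proj₂ b →
            proj₁ b ⊔ proj₁ c < proj₂ b ⊓ proj₂ c
overlap⇒⊔<⊓ b₁<b₂ c₁<c₂ b₁<c₂ c₁<b₂ =
  ⊔-lub-< (⊓-glb-< b₁<b₂ b₁<c₂) (⊓-glb-< c₁<b₂ c₁<c₂)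

module _ (J : 𝓡) where
  open 𝓡 J

  interpolate : ∀ {a} → I a → ∃[ c ] (I c × a ≺ c)
  interpolate {a} a∈J with directed a a a∈J a∈J
  ... | c , c∈J , a≺c , _ = c , c∈J , a≺c

  members-overlap : ∀ {a b} → I a → I b → proj₁ a < proj₂ b
  members-overlap {a} {b} a∈J b∈J with directed a b a∈J b∈J
  ... | _ , _ , (a₁<c₁ , c₁<c₂ , _) , (_ , _ , c₂<b₂) =
    <-trans a₁<c₁ (<-trans c₁<c₂ c₂<b₂)

  widen : ∀ {p q p' q'} → I (p , q) → p' ≤ p → q ≤ q' → I (p' , q')
  widen {p' = p'} {q'} pq∈J p'≤p q≤q' with interpolate pq∈J
  ... | c , c∈J , (p<c₁ , c₁<c₂ , c₂<q) =
    lower (p' , q') c (≤-<-trans p'≤p p<c₁ , c₁<c₂ , <-≤-trans c₂<q q≤q') c∈J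

  join : ∀ {p q p' q'} → I (p , q') → I (p' , q) → I (p , q)
  join {p} {q} pq'∈J p'q∈J with directed _ _ pq'∈J p'q∈J
  ... | c , c∈J , (p<c₁ , c₁<c₂ , _) , (_ , _ , c₂<q) = lower (p , q) c (p<c₁ , c₁<c₂ , c₂<q) c∈J

↡ : (b : ℚ × ℚ) → proj₁ b < proj₂ b → 𝓡
↡ b b₁<b₂ = record
  { I         = _≺ b
  ; ordered   = λ _ _ (a₁<b₁ , _ , b₂<a₂) → <-trans a₁<b₁ (<-trans b₁<b₂ b₂<a₂)
  ; lower     = λ a c a≺c c≺b → ≺-trans a≺c c≺b
  ; inhabited = ≺-wider b₁<b₂
  ; directed  = directed↡
  }
  where
  directed↡ : ∀ a a' → a ≺ b → a' ≺ b → ∃[ c ] (c ≺ b × a ≺ c × a' ≺ c)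
  directed↡ (a₁ , a₂) (a₁' , a₂') (a₁<b₁ , _ , b₂<a₂) (a₁'<b₁ , _ , b₂<a₂')
    with <-dense (⊔-lub-< a₁<b₁ a₁'<b₁) | <-dense (⊓-glb-< b₂<a₂ b₂<a₂')
  ... | c₁ , a₁⊔a₁'<c₁ , c₁<b₁ | c₂ , b₂<c₂ , c₂<a₂⊓a₂' =
    (c₁ , c₂) , (c₁<b₁ , b₁<b₂ , b₂<c₂)
    , (≤-<-trans (p≤p⊔q a₁ a₁') a₁⊔a₁'<c₁ , c₁<c₂ , <-≤-trans c₂<a₂⊓a₂' (p⊓q≤p a₂ a₂'))
    , (≤-<-trans (p≤q⊔p a₁ a₁') a₁⊔a₁'<c₁ , c₁<c₂ , <-≤-trans c₂<a₂⊓a₂' (p⊓q≤q a₂ a₂'))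
    where
    c₁<c₂ : c₁ < c₂
    c₁<c₂ = <-trans c₁<b₁ (<-trans b₁<b₂ b₂<c₂)

↡-mono : ∀ {b c} (b₁<b₂ : proj₁ b < proj₂ b) (c₁<c₂ : proj₁ c < proj₂ c) →
         proj₁ b ≤ proj₁ c → proj₂ c ≤ proj₂ b → ↡ b b₁<b₂ ⊑ ↡ c c₁<c₂
↡-mono _ c₁<c₂ b₁≤c₁ c₂≤b₂ _ (a₁<b₁ , _ , b₂<a₂) =
  <-≤-trans a₁<b₁ b₁≤c₁ , c₁<c₂ , ≤-<-trans c₂≤b₂ b₂<a₂

↡-overlap-bound : ∀ {b c} (b₁<b₂ : proj₁ b < proj₂ b) (c₁<c₂ : proj₁ c < proj₂ c) →
                  proj₁ b < proj₂ c → proj₁ c < proj₂ b →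
                  ∃[ d ] (↡ b b₁<b₂ ⊑ d × ↡ c c₁<c₂ ⊑ d)
↡-overlap-bound {b₁ , b₂} {c₁ , c₂} b₁<b₂ c₁<c₂ b₁<c₂ c₁<b₂ =
  ↡ (b₁ ⊔ c₁ , b₂ ⊓ c₂) d₁<d₂
  , ↡-mono b₁<b₂ d₁<d₂ (p≤p⊔q b₁ c₁) (p⊓q≤p b₂ c₂)
  , ↡-mono c₁<c₂ d₁<d₂ (p≤q⊔p b₁ c₁) (p⊓q≤q b₂ c₂)
  where
  d₁<d₂ : b₁ ⊔ c₁ < b₂ ⊓ c₂
  d₁<d₂ = overlap⇒⊔<⊓ b₁<b₂ c₁<c₂ b₁<c₂ c₁<b₂

⋃ : {Idx : Set} (α : Idx → 𝓡) → IsDirected α → 𝓡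
⋃ {Idx} α (i₀ , α-directed) = record
  { I         = λ a → Σ Idx λ i → 𝓡.I (α i) a
  ; ordered   = λ p q (i , pq∈αi) → 𝓡.ordered (α i) p q pq∈αi
  ; lower     = λ a b a≺b (i , b∈αi) → i , 𝓡.lower (α i) a b a≺b b∈αi
  ; inhabited = let (a , a∈αi₀) = 𝓡.inhabited (α i₀) in a , i₀ , a∈αi₀
  ; directed  = directed⋃
  }
  where
  directed⋃ : ∀ a b → Σ Idx (λ i → 𝓡.I (α i) a) → Σ Idx (λ j → 𝓡.I (α j) b) →
              ∃[ c ] (Σ Idx (λ k → 𝓡.I (α k) c) × a ≺ c × b ≺ c)
  directed⋃ a b (i , a∈αi) (j , b∈αj) with α-directed i j
  ... | k , αi⊑αk , αj⊑αk with 𝓡.directed (α k) a b (αi⊑αk a a∈αi) (αj⊑αk b b∈αj)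
  ...   | c , c∈αk , a≺c , b≺c = c , (k , c∈αk) , a≺c , b≺c

IsSup⇒⊑⋃ : ∀ {Idx : Set} (α : Idx → 𝓡) (α-directed : IsDirected α) z →
           IsSup α z → z ⊑ ⋃ α α-directed
IsSup⇒⊑⋃ α α-directed _ (_ , least) = least (⋃ α α-directed) (λ i _ a∈αi → i , a∈αi)

basis : (v : 𝓡) → Σ (ℚ × ℚ) (𝓡.I v) → 𝓡
basis v (c , c∈v) = ↡ c (𝓡.ordered v _ _ c∈v)

basis-directed : (v : 𝓡) → IsDirected (basis v)
basis-directed v = 𝓡.inhabited v , upper-bound
  where
  upper-bound : ∀ i j → ∃[ k ] (basis v i ⊑ basis v k × basis v j ⊑ basis v k)
  upper-bound (c , c∈v) (c' , c'∈v) with 𝓡.directed v c c' c∈v c'∈v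
  ... | d , d∈v , c≺d , c'≺d =
    (d , d∈v) , (λ _ a≺c → ≺-trans a≺c c≺d) , (λ _ a≺c' → ≺-trans a≺c' c'≺d)

basis-isSup : (v : 𝓡) → IsSup (basis v) v
basis-isSup v = (λ (c , c∈v) a a≺c → 𝓡.lower v a c a≺c c∈v) , least
  where
  least : ∀ w → (∀ i → basis v i ⊑ w) → v ⊑ w
  least w basis⊑w a a∈v with interpolate v a∈v
  ... | c , c∈v , a≺c = basis⊑w (c , c∈v) a a≺c

_⊑↡_ : 𝓡 → ℚ × ℚ → Set
u ⊑↡ b = ∀ a → 𝓡.I u a → a ≺ b

≪-intro : ∀ u v {b} → 𝓡.I v b → u ⊑↡ b → u ≪ v
≪-intro _ _ {b} b∈v u⊑↡b α α-directed z z-sup v⊑z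
  with IsSup⇒⊑⋃ α α-directed z z-sup b (v⊑z b b∈v)
... | i , b∈αi = i , λ a a∈u → 𝓡.lower (α i) a b (u⊑↡b a a∈u) b∈αi

≪-elim : ∀ u v → u ≪ v → ∃[ b ] (𝓡.I v b × u ⊑↡ b)
≪-elim _ v u≪v with u≪v (basis v) (basis-directed v) v (basis-isSup v) (λ _ a∈v → a∈v)
... | (b , b∈v) , u⊑↡b = b , b∈v , u⊑↡b

Meets : (ℚ × ℚ → Set) → 𝓡 → Set₁
Meets Q d = Lift _ (∃[ a ] (𝓡.I d a × Q a))

Meets-isScottOpen : ∀ Q → IsScottOpen (Meets Q)
Meets-isScottOpen Q = upward , inaccessible
  where
  upward : ∀ d d' → d ⊑ d' → Meets Q d → Meets Q d'
  upward _ _ d⊑d' (lift (a , a∈d , Qa)) = lift (a , d⊑d' a a∈d , Qa)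
  inaccessible : ∀ {Idx : Set} (α : Idx → 𝓡) → IsDirected α →
                 ∀ z → IsSup α z → Meets Q z → ∃[ i ] Meets Q (α i)
  inaccessible α α-directed z z-sup (lift (a , a∈z , Qa)) with IsSup⇒⊑⋃ α α-directed z z-sup a a∈z
  ... | i , a∈αi = i , lift (a , a∈αi , Qa)

Separated : 𝓡 → 𝓡 → Set₂
Separated v w = Σ (𝓡 → Set₁) λ O → Σ (𝓡 → Set₁) λ P →
  IsScottOpen O × IsScottOpen P × O v × P w × (∀ d → O d → P d → ⊥)

Separated-sym : ∀ {v w} → Separated v w → Separated w v
Separated-sym (O , P , O-open , P-open , Ov , Pw , disjoint) =
  P , O , P-open , O-open , Pw , Ov , λ d Pd Od → disjoint d Od Pd

Meets-separated : ∀ {Q R v w} → (∀ {a b} → Q a → R b → proj₂ a ≤ proj₁ b) →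
                  Meets Q v → Meets R w → Separated v w
Meets-separated {Q} {R} Q-left-of-R Qv Rw =
  Meets Q , Meets R , Meets-isScottOpen Q , Meets-isScottOpen R , Qv , Rw , disjoint
  where
  disjoint : ∀ d → Meets Q d → Meets R d → ⊥
  disjoint d (lift (a , a∈d , Qa)) (lift (b , b∈d , Rb)) =
    <-irrefl refl (<-≤-trans (members-overlap d b∈d a∈d) (Q-left-of-R Qa Rb))

Separated⇒no-upper-bound : ∀ v w d → Separated v w → v ⊑ d → w ⊑ d → ⊥
Separated⇒no-upper-bound v w d (_ , _ , (O-up , _) , (P-up , _) , Ov , Pw , disjoint) v⊑d w⊑d =
  disjoint d (O-up v d v⊑d Ov) (P-up w d w⊑d Pw)

Separated-basis : ∀ {v w} → Separated v w → ∃[ c ] Separated v (basis w c)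
Separated-basis {w = w} (O , P , O-open , P-open , Ov , Pw , disjoint)
  with proj₂ P-open (basis w) (basis-directed w) w (basis-isSup w) Pw
... | c , Pc = c , O , P , O-open , P-open , Ov , Pc , disjoint

module _ (J : 𝓡) (x : ℝ) (J≈ιx : ∀ a → 𝓡.I J a ⟷ ι x a) where
  open ℝ x

  Meets-left-of : ∀ {q} → U q → Meets (λ a → proj₂ a < q) J
  Meets-left-of {q} Uq with proj₁ (rounded-U q) Uq | bounded-L
  ... | s , s<q , Us | r , Lr = lift ((r , s) , proj₂ (J≈ιx (r , s)) (Lr , Us) , s<q)

  Meets-right-of : ∀ {p} → L p → Meets (λ a → p < proj₁ a) J
  Meets-right-of {p} Lp with proj₁ (rounded-L p) Lp | bounded-U
  ... | r , p<r , Lr | s , Us = lift ((r , s) , proj₂ (J≈ιx (r , s)) (Lr , Us) , p<r)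

InImageι⇒StronglyMaximal : ∀ J → InImageι J → StronglyMaximal J
InImageι⇒StronglyMaximal J (x , J≈ιx) u v u≪v with ≪-elim u v u≪v
... | (p , q) , pq∈v , u⊑↡pq with interpolate v pq∈v
... | (p' , q') , p'q'∈v , (p<p' , _ , q'<q)
      with ℝ.located x p p' p<p' | ℝ.located x q' q q'<q
... | inj₂ x<p' | _ =
  inj₂ (Separated-sym (Meets-separated (λ a₂<p' p'≤b₁ → <⇒≤ (<-≤-trans a₂<p' p'≤b₁))
                                       (Meets-left-of J x J≈ιx x<p')
                                       (lift ((p' , q') , p'q'∈v , ≤-refl))))
... | inj₁ _ | inj₁ q'<x =
  inj₂ (Meets-separated (λ a₂≤q' q'<b₁ → <⇒≤ (≤-<-trans a₂≤q' q'<b₁))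
                        (lift ((p' , q') , p'q'∈v , ≤-refl))
                        (Meets-right-of J x J≈ιx q'<x))
... | inj₁ p<x | inj₂ x<q = inj₁ (≪-intro u J (proj₂ (J≈ιx (p , q)) (p<x , x<q)) u⊑↡pq)

module Cuts (J : 𝓡) where
  open 𝓡 J

  Lower Upper : ℚ → Set
  Lower p = ∃[ q ] I (p , q)
  Upper q = ∃[ p ] I (p , q)

  Located : Set
  Located = ∀ p q → p < q → Lower p ⊎ Upper q

  Lower-rounded : ∀ p → Lower p ⟷ (∃[ r ] (p < r × Lower r))
  Lower-rounded p =
    (λ (q , pq∈J) → let ((c₁ , c₂) , c∈J , p<c₁ , _) = interpolate J pq∈J
                     in c₁ , p<c₁ , c₂ , c∈J)
    , λ (r , p<r , q , rq∈J) → q , widen J rq∈J (<⇒≤ p<r) ≤-refl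

  Upper-rounded : ∀ q → Upper q ⟷ (∃[ s ] (s < q × Upper s))
  Upper-rounded q =
    (λ (p , pq∈J) → let ((c₁ , c₂) , c∈J , _ , _ , c₂<q) = interpolate J pq∈J
                     in c₂ , c₂<q , c₁ , c∈J)
    , λ (s , s<q , p , ps∈J) → p , widen J ps∈J ≤-refl (<⇒≤ s<q)

  toℝ : Located → ℝ
  toℝ located = record
    { L          = Lower
    ; U          = Upper
    ; bounded-L  = let ((p , q) , pq∈J) = inhabited in p , q , pq∈J
    ; bounded-U  = let ((p , q) , pq∈J) = inhabited in q , p , pq∈J
    ; rounded-L  = Lower-rounded
    ; rounded-U  = Upper-rounded
    ; transitive = λ p q (_ , pq'∈J) (_ , p'q∈J) → ordered p q (join J pq'∈J p'q∈J)
    ; located    = located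
    }

  toℝ-image : (located : Located) → ∀ a → I a ⟷ ι (toℝ located) a
  toℝ-image _ (p , q) =
    (λ pq∈J → (q , pq∈J) , (p , pq∈J)) , λ ((_ , pq'∈J) , (_ , p'q∈J)) → join J pq'∈J p'q∈J

  Separated⇒Lower⊎Upper : ∀ {p q c} (c₁<c₂ : proj₁ c < proj₂ c) → p < proj₁ c → proj₂ c < q →
                          Separated (↡ c c₁<c₂) J → Lower p ⊎ Upper q
  Separated⇒Lower⊎Upper {c = c₁ , c₂} c₁<c₂ p<c₁ c₂<q c#J with Separated-basis c#J
  ... | ((b₁ , b₂) , b∈J) , c#b with b₂ ≤? c₁ | c₂ ≤? b₁
  ... | yes b₂≤c₁ | _ =
    inj₂ (b₁ , widen J b∈J ≤-refl (<⇒≤ (≤-<-trans b₂≤c₁ (<-trans c₁<c₂ c₂<q))))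
  ... | no _ | yes c₂≤b₁ =
    inj₁ (b₂ , widen J b∈J (<⇒≤ (<-trans p<c₁ (<-≤-trans c₁<c₂ c₂≤b₁))) ≤-refl)
  ... | no b₂≰c₁ | no c₂≰b₁ =
    let (d , c⊑d , b⊑d) = ↡-overlap-bound c₁<c₂ (ordered b₁ b₂ b∈J) (≰⇒> b₂≰c₁) (≰⇒> c₂≰b₁)
    in ⊥-elim (Separated⇒no-upper-bound _ _ d c#b c⊑d b⊑d)

  StronglyMaximal⇒Located : StronglyMaximal J → Located
  StronglyMaximal⇒Located sm p q p<q with ≺-narrower p<q
  ... | (r , s) , pq≺rs@(p<r , r<s , s<q) with ≺-narrower r<s
  ... | (r' , s') , rs≺rs'@(r<r' , r'<s' , s'<s)
        with sm (↡ (r , s) r<s) (↡ (r' , s') r'<s')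
                (≪-intro (↡ (r , s) r<s) (↡ (r' , s') r'<s') rs≺rs' (λ _ a≺rs → a≺rs))
  ... | inj₁ ↡rs≪J =
    let (b , b∈J , ↡rs⊑↡b) = ≪-elim (↡ (r , s) r<s) J ↡rs≪J
    in inj₁ (q , lower (p , q) b (↡rs⊑↡b (p , q) pq≺rs) b∈J)
  ... | inj₂ rs'#J = Separated⇒Lower⊎Upper r'<s' (<-trans p<r r<r') (<-trans s'<s s<q) rs'#J

theorem7p15 : ∀ (J : 𝓡) → (InImageι J → StronglyMaximal J) × (StronglyMaximal J → InImageι J)
theorem7p15 J = InImageι⇒StronglyMaximal J , λ sm →
  let open Cuts J
      located = StronglyMaximal⇒Located sm
  in toℝ located , toℝ-image located
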